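{- Let $G$ be a subgraph with $n\ge1$ vertices of a Cartesian product $\Gamma=G_1\square\cdots\square G_m$ of finite connected graphs. Then $\mathrm{vcd}^*(G)\le\log n$, where $\mathrm{vcd}^*(G)$ is computed with respect to $\Gamma$.
   Context: All graphs finite, simple, undirected; $\log$ is base 2. The Cartesian product has vertex set $V(G_1)\times\cdots\times V(G_m)$, two tuples adjacent iff they differ in exactly one coordinate $j$ where they are adjacent in $G_j$. Minor-subproducts: for each $i$, let $\mathcal P_i=\{P^i_1,\ldots,P^i_{t_i}\}$ be a partition of $V(G_i)$ into sets inducing connected subgraphs of $G_i$, and $M_i$ a graph on vertex set $\mathcal P_i$ such that parts adjacent in $M_i$ are joined by an edge of $G_i$; $M=M_1\square\cdots\square M_m$ is a minor-subproduct, shattered by $G$ if each set $P^1_{l_1}\times\cdots\times P^m_{l_m}$ contains a vertex of $G$. A factor is non-trivial if it has at least two vertices. $\mathrm{vcd}^*(G)$ is the largest number of non-trivial factors of a minor-subproduct of $\Gamma$ shattered by $G$. -}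

module Defs where

open import Data.Nat using (ℕ; zero; suc; _<_; _≤_)
open import Data.Fin using (Fin; zero; suc)
open import Data.Product using (Σ; ∃; ∃₂; _×_; _,_)
open import Data.Unit using (⊤)
open import Relation.Nullary using (¬_)
open import Relation.Binary.PropositionalEquality using (_≡_; _≢_)

record Graph : Set₁ where
  field
    V      : ℕ
    Adj    : Fin V → Fin V → Set
    sym    : ∀ {x y} → Adj x y → Adj y x
    irrefl : ∀ {x} → ¬ Adj x x
open Graph public

-- Walks from x to z all of whose vertices satisfy P (walks inside the
-- subgraph induced by P).
data ReachIn (G : Graph) (P : Fin (V G) → Set) : Fin (V G) → Fin (V G) → Set where
  here : ∀ {x} → P x → ReachIn G P x x
  step : ∀ {x y z} → P x → Adj G x y → ReachIn G P y z → ReachIn G P x z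

Connected : Graph → Set
Connected G = (0 < V G) × (∀ x y → ReachIn G (λ _ → ⊤) x y)

ProdV : (m : ℕ) → (Fin m → Graph) → Set
ProdV m Gs = (i : Fin m) → Fin (V (Gs i))

ProdAdj : (m : ℕ) (Gs : Fin m → Graph) → ProdV m Gs → ProdV m Gs → Set
ProdAdj m Gs x y =
  Σ (Fin m) λ i → Adj (Gs i) (x i) (y i) × (∀ j → j ≢ i → x j ≡ y j)

-- A subgraph G of Γ with n vertices: its vertices are the image of an
-- injective (pointwise) map emb : Fin n → V(Γ); its edges are a symmetric
-- relation on Fin n contained in the edges of Γ.
record Subgraph (m : ℕ) (Gs : Fin m → Graph) : Set₁ where
  field
    n       : ℕ
    emb     : Fin n → ProdV m Gs
    emb-inj : ∀ a b → (∀ i → emb a i ≡ emb b i) → a ≡ b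
    E       : Fin n → Fin n → Set
    E-sym   : ∀ {a b} → E a b → E b a
    E-sub   : ∀ {a b} → E a b → ProdAdj m Gs (emb a) (emb b)
open Subgraph public

-- One factor of a minor-subproduct: a partition of V(G) into t nonempty
-- parts (part x = index of the part containing x), each inducing a connected
-- subgraph, plus a simple graph M on the parts whose edges are realised by
-- edges of G.
record MinorFactor (G : Graph) : Set₁ where
  field
    t        : ℕ
    part     : Fin (V G) → Fin t
    nonempty : ∀ l → ∃ λ x → part x ≡ l
    partConn : ∀ x y → part x ≡ part y → ReachIn G (λ z → part z ≡ part x) x y
    MAdj     : Fin t → Fin t → Set
    M-sym    : ∀ {a b} → MAdj a b → MAdj b a
    M-irrefl : ∀ {a} → ¬ MAdj a a
    M-edge   : ∀ {a b} → MAdj a b →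
               ∃₂ λ x y → part x ≡ a × part y ≡ b × Adj G x y
open MinorFactor public

MinorSubproduct : (m : ℕ) → (Fin m → Graph) → Set₁
MinorSubproduct m Gs = (i : Fin m) → MinorFactor (Gs i)

Shattered : (m : ℕ) (Gs : Fin m → Graph) → Subgraph m Gs → MinorSubproduct m Gs → Set
Shattered m Gs S M =
  (l : (i : Fin m) → Fin (t (M i))) →
  ∃ λ (k : Fin (n S)) → ∀ i → part (M i) (emb S k i) ≡ l i

countNontrivial : (m : ℕ) → (Fin m → ℕ) → ℕ
countNontrivial zero    f = 0
countNontrivial (suc m) f with f zero
... | suc (suc _) = suc (countNontrivial m (λ i → f (suc i)))
... | _           = countNontrivial m (λ i → f (suc i))

nontrivialFactors : (m : ℕ) (Gs : Fin m → Graph) → MinorSubproduct m Gs → ℕ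
nontrivialFactors m Gs M = countNontrivial m (λ i → t (M i))

module Submission where

-- Let t_i be the number of parts of the i-th factor of a
-- minor-subproduct M shattered by G, and N = t_0 · … · t_{m-1} the number of
-- vertices of M.  Two counting facts give 2^k ≤ N ≤ n, where k is the number
-- of non-trivial factors:
--   * 2^k ≤ N whenever every t_i ≥ 1, since each non-trivial factor
--     contributes a factor ≥ 2 to N and each trivial one a factor 1
--     (every t_i ≥ 1 because the factor graphs are connected, hence nonempty,
--     and every vertex lies in some part);
--   * N ≤ n because shattering picks, for every tuple of parts, a vertex of G
--     lying in that product of parts, and the tuple can be read back off the
--     vertex; so tuples of parts inject into V(G).

open import Defs hiding (sym)
open import Data.Nat using (ℕ; zero; suc; _*_; _^_; _≤_; z≤n; s≤s)
open import Data.Nat.Properties using (≤-refl; ≤-trans; *-mono-≤; m≤m+n)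
open import Data.Fin using (Fin; combine; remQuot; fromℕ<) renaming (zero to fzero; suc to fsuc)
open import Data.Fin.Properties using (injective⇒≤; combine-remQuot)
open import Data.Product using (_×_; _,_; proj₁; proj₂)
open import Relation.Binary.PropositionalEquality
  using (_≡_; refl; sym; trans; cong; cong₂; module ≡-Reasoning)

prod : (m : ℕ) → (Fin m → ℕ) → ℕ
prod zero    t = 1
prod (suc m) t = t fzero * prod m (λ i → t (fsuc i))

-- Tuples choosing an element of Fin (t i) for each i; for a minor-subproduct
-- these are exactly its vertices (tuples of parts).
Tuple : (m : ℕ) → (Fin m → ℕ) → Set
Tuple m t = (i : Fin m) → Fin (t i)

_≗ᵗ_ : {m : ℕ} {t : Fin m → ℕ} → Tuple m t → Tuple m t → Set
l ≗ᵗ l' = ∀ i → l i ≡ l' i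

pow-countNontrivial≤prod : (m : ℕ) (t : Fin m → ℕ) → (∀ i → 1 ≤ t i) →
  2 ^ countNontrivial m t ≤ prod m t
pow-countNontrivial≤prod zero    t pos = ≤-refl
pow-countNontrivial≤prod (suc m) t pos
  with t fzero | pos fzero | pow-countNontrivial≤prod m (λ i → t (fsuc i)) (λ i → pos (fsuc i))
... | zero        | () | _
... | suc zero    | _  | ih = ≤-trans ih (m≤m+n _ 0)
... | suc (suc k) | _  | ih = *-mono-≤ (s≤s (s≤s (z≤n {k}))) ih

-- Mixed-radix decoding of an index into a tuple: the first coordinate is the
-- "quotient" digit, the rest are decoded recursively from the remainder.
decode : (m : ℕ) (t : Fin m → ℕ) → Fin (prod m t) → Tuple m t
decode zero    t x ()
decode (suc m) t x fzero    = proj₁ (remQuot {t fzero} (prod m (λ i → t (fsuc i))) x)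
decode (suc m) t x (fsuc i) =
  decode m (λ i → t (fsuc i)) (proj₂ (remQuot {t fzero} (prod m (λ i → t (fsuc i))) x)) i

decode-injective : (m : ℕ) (t : Fin m → ℕ) (x y : Fin (prod m t)) →
  decode m t x ≗ᵗ decode m t y → x ≡ y
decode-injective zero    t fzero fzero _  = refl
decode-injective (suc m) t x     y     eq = begin
  x                                  ≡⟨ sym (combine-remQuot {t fzero} r x) ⟩
  combine (proj₁ (split x)) (proj₂ (split x))
    ≡⟨ cong₂ combine (eq fzero) (decode-injective m t′ _ _ (λ i → eq (fsuc i))) ⟩
  combine (proj₁ (split y)) (proj₂ (split y)) ≡⟨ combine-remQuot {t fzero} r y ⟩
  y                                  ∎
  where
  open ≡-Reasoning
  t′ : Fin m → ℕ
  t′ i = t (fsuc i)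
  r : ℕ
  r = prod m t′
  split : Fin (prod (suc m) t) → Fin (t fzero) × Fin r
  split = remQuot {t fzero} r

prod≤ : (m : ℕ) (t : Fin m → ℕ) (n : ℕ) (f : Tuple m t → Fin n) →
  (∀ l l' → f l ≡ f l' → l ≗ᵗ l') → prod m t ≤ n
prod≤ m t n f f-inj =
  injective⇒≤ (λ {x} {y} e → decode-injective m t x y (f-inj _ _ e))

inhabited⇒positive : {k : ℕ} → Fin k → 1 ≤ k
inhabited⇒positive fzero    = s≤s z≤n
inhabited⇒positive (fsuc _) = s≤s z≤n

partCount-positive : {G : Graph} → Connected G → (F : MinorFactor G) → 1 ≤ t F
partCount-positive (nonempty , _) F = inhabited⇒positive (part F (fromℕ< nonempty))

-- vcd*(G) ≤ log n: 2^k ≤ (number of tuples of parts) ≤ n.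
lemma6p3 : (m : ℕ) (Gs : Fin m → Graph) → (∀ i → Connected (Gs i)) →
    (S : Subgraph m Gs) → 1 ≤ n S →
    (M : MinorSubproduct m Gs) → Shattered m Gs S M →
    2 ^ nontrivialFactors m Gs M ≤ n S
lemma6p3 m Gs conn S _ M shattered =
  ≤-trans (pow-countNontrivial≤prod m parts (λ i → partCount-positive (conn i) (M i)))
          (prod≤ m parts (n S) witness witness-injective)
  where
  parts : Fin m → ℕ
  parts i = t (M i)
  witness : Tuple m parts → Fin (n S)
  witness l = proj₁ (shattered l)
  -- The tuple of parts is recovered as the parts containing the witness.
  witness-injective : ∀ l l' → witness l ≡ witness l' → l ≗ᵗ l'
  witness-injective l l' e i =
    trans (sym (proj₂ (shattered l) i))
          (trans (cong (λ k → part (M i) (emb S k i)) e) (proj₂ (shattered l') i))
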